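{- For every positive integer $n$, $s(n+1) \le s(n) + 1$.
   Context: $n \bmod k$ denotes the least nonnegative remainder of $n$ upon division by $k$. $S(n) := \{ n \bmod k : k \in \{1,2,\ldots,\lfloor n/2\rfloor\}\}$ and $s(n) := |S(n)|$. -}

module Defs where

open import Data.Nat using (ℕ; suc)
open import Data.Nat.Properties using (_≟_)
open import Data.Nat.DivMod using (_%_; _/_)
open import Data.List using (List; map; length; deduplicate; upTo)

-- S(n) = { n mod k : k ∈ {1, ..., ⌊n/2⌋} }, as a duplicate-free list
-- (k ranges over suc j for j ∈ upTo ⌊n/2⌋ = [0 .. ⌊n/2⌋-1])
S : ℕ → List ℕ
S n = deduplicate _≟_ (map (λ k → _%_ n (suc k)) (upTo (n / 2)))

s : ℕ → ℕ
s n = length (S n)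

{-# OPTIONS --safe #-}
-- The remainder of n + 1 modulo k is 0 or one more than the remainder of n, so
-- each k ≤ ⌊n/2⌋ contributes to S(n + 1) an element of {0} ∪ (S(n) + 1).  Raising
-- the range to ⌊(n + 1)/2⌋ adds a divisor k only when n + 1 = 2k, and then the
-- remainder is 0.  A duplicate-free list inside a list is no longer than it.
module Submission where

open import Defs
open import Data.Nat using (ℕ; _≤_; _+_; _<_; suc; _*_; s≤s; z≤n; NonZero; _≟_; _≤?_)
open import Data.Nat.Properties
open import Data.Nat.DivMod
open import Data.List using (List; []; _∷_; map; length)
open import Data.List.Properties using (length-map; length-removeAt′)
open import Data.List.Relation.Unary.Any using (here; there; index)
open import Data.List.Relation.Unary.AllPairs using (_∷_)
open import Data.List.Relation.Unary.All using () renaming (lookup to All-lookup)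
open import Data.List.Relation.Unary.Unique.Propositional using (Unique)
open import Data.List.Relation.Unary.Unique.DecPropositional.Properties using (deduplicate-!)
open import Data.List.Membership.Propositional using (_∈_; _─_)
open import Data.List.Membership.Propositional.Properties
  using (∈-map⁺; ∈-map⁻; ∈-upTo⁺; ∈-upTo⁻; ∈-deduplicate⁺; ∈-deduplicate⁻)
open import Data.List.Relation.Binary.Subset.Propositional using (_⊆_)
open import Data.Product using (∃-syntax; _×_; _,_)
open import Data.Sum using (_⊎_; inj₁; inj₂)
open import Function using (_∘_)
open import Relation.Nullary using (yes; no; contradiction)
open import Relation.Binary.PropositionalEquality

∈-─ : ∀ {a} {A : Set a} {x z : A} {ys : List A} (x∈ys : x ∈ ys) →
      z ∈ ys → z ≢ x → z ∈ ys ─ x∈ys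
∈-─ (here refl)  (here refl)  z≢x = contradiction refl z≢x
∈-─ (here _)     (there z∈ys) _   = z∈ys
∈-─ (there _)    (here z≡y)   _   = here z≡y
∈-─ (there x∈ys) (there z∈ys) z≢x = there (∈-─ x∈ys z∈ys z≢x)

Unique∧⊆⇒length-≤ : ∀ {a} {A : Set a} {xs ys : List A} →
                    Unique xs → xs ⊆ ys → length xs ≤ length ys
Unique∧⊆⇒length-≤ {xs = []}     _              _  = z≤n
Unique∧⊆⇒length-≤ {xs = x ∷ xs} {ys} (x∉xs ∷ u) xs⊆ys = begin
  suc (length xs)          ≤⟨ s≤s (Unique∧⊆⇒length-≤ u xs⊆ys─x) ⟩
  suc (length (ys ─ x∈ys)) ≡⟨ length-removeAt′ ys (index x∈ys) ⟨
  length ys                ∎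
  where
  open ≤-Reasoning
  x∈ys : x ∈ ys
  x∈ys = xs⊆ys (here refl)
  xs⊆ys─x : xs ⊆ ys ─ x∈ys
  xs⊆ys─x z∈xs = ∈-─ x∈ys (xs⊆ys (there z∈xs)) (All-lookup x∉xs z∈xs ∘ sym)

suc-%≡suc-%-% : ∀ m d .{{_ : NonZero d}} → suc m % d ≡ suc (m % d) % d
suc-%≡suc-%-% m d = begin
  suc m % d                         ≡⟨ %-congˡ (cong suc (m≡m%n+[m/n]*n m d)) ⟩
  (suc (m % d) + (m / d) * d) % d   ≡⟨ [m+kn]%n≡m%n (suc (m % d)) (m / d) d ⟩
  suc (m % d) % d                   ∎
  where open ≡-Reasoning

suc-%-cases : ∀ m d .{{_ : NonZero d}} → suc m % d ≡ 0 ⊎ suc m % d ≡ suc (m % d)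
suc-%-cases m d with m≤n⇒m<n∨m≡n (m%n<n m d)
... | inj₁ 1+r<d = inj₂ (trans (suc-%≡suc-%-% m d) (m<n⇒m%n≡m 1+r<d))
... | inj₂ 1+r≡d = inj₁ (trans (suc-%≡suc-%-% m d) (trans (%-congˡ 1+r≡d) (n%n≡0 d)))

half-suc-cases : ∀ n k → k ≤ suc n / 2 → k ≤ n / 2 ⊎ 2 * k ≡ suc n
half-suc-cases n k k≤[1+n]/2 with k ≤? n / 2
... | yes k≤n/2 = inj₁ k≤n/2
... | no  k≰n/2 = inj₂ (trans (*-comm 2 k) (≤-antisym upper lower))
  where
  open ≤-Reasoning
  upper : k * 2 ≤ suc n
  upper = ≤-trans (*-monoˡ-≤ 2 k≤[1+n]/2) (m/n*n≤m (suc n) 2)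
  lower : suc n ≤ k * 2
  lower = begin
    suc n                     ≡⟨ cong suc (m≡m%n+[m/n]*n n 2) ⟩
    suc (n % 2 + n / 2 * 2)   ≤⟨ s≤s (+-monoˡ-≤ (n / 2 * 2) (≤-pred (m%n<n n 2))) ⟩
    suc (n / 2) * 2           ≤⟨ *-monoˡ-≤ 2 (≰⇒> k≰n/2) ⟩
    k * 2                     ∎

∈-S⁺ : ∀ n j → j < n / 2 → n % suc j ∈ S n
∈-S⁺ n j j<n/2 = ∈-deduplicate⁺ _≟_ (∈-map⁺ (λ i → n % suc i) (∈-upTo⁺ j<n/2))

∈-S⁻ : ∀ n {r} → r ∈ S n → ∃[ j ] j < n / 2 × r ≡ n % suc j
∈-S⁻ n r∈S with ∈-map⁻ (λ i → n % suc i) (∈-deduplicate⁻ _≟_ _ r∈S)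
... | j , j∈upTo , r≡ = j , ∈-upTo⁻ j∈upTo , r≡

S-suc-⊆ : ∀ n → S (suc n) ⊆ 0 ∷ map suc (S n)
S-suc-⊆ n r∈S with ∈-S⁻ (suc n) r∈S
... | j , j<[1+n]/2 , refl with half-suc-cases n (suc j) j<[1+n]/2
...   | inj₂ 2[1+j]≡1+n = here (trans (%-congˡ {o = suc j} (sym 2[1+j]≡1+n)) (m*n%n≡0 2 (suc j)))
...   | inj₁ j<n/2 with suc-%-cases n (suc j)
...     | inj₁ ≡0   = here ≡0
...     | inj₂ ≡suc = there (subst (_∈ map suc (S n)) (sym ≡suc) (∈-map⁺ suc (∈-S⁺ n j j<n/2)))

proposition4p2 : (n : ℕ) → 0 < n → s (n + 1) ≤ s n + 1
proposition4p2 n _ = begin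
  s (n + 1)                   ≡⟨ cong s (+-comm n 1) ⟩
  length (S (suc n))          ≤⟨ Unique∧⊆⇒length-≤ (deduplicate-! _≟_ _) (S-suc-⊆ n) ⟩
  length (0 ∷ map suc (S n))  ≡⟨ cong suc (length-map suc (S n)) ⟩
  suc (s n)                   ≡⟨ +-comm 1 (s n) ⟩
  s n + 1                     ∎
  where open ≤-Reasoning
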